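{- Let $L$ be a residuated lattice, $n\geq 1$ an integer, and let $F_1$ and $F_2$ be filters of $L$ with $F_1\subseteq F_2$. If $F_1$ is an $n$-fold fantastic filter of $L$, then so is $F_2$.
   Context: A residuated lattice is an algebra $(L,\wedge,\vee,\otimes,\rightarrow,0,1)$ such that $(L,\wedge,\vee,0,1)$ is a bounded lattice, $(L,\otimes,1)$ is a commutative monoid, and $x\otimes y\leq z$ iff $x\leq y\rightarrow z$. A filter of $L$ is a nonempty subset closed under $\otimes$ and upward closed. For $x\in L$, $x^n=x\otimes\cdots\otimes x$ ($n$ factors). A subset $F\subseteq L$ is an $n$-fold fantastic filter if $1\in F$ and for all $x,y\in L$: $y\rightarrow x\in F$ implies $((x^n\rightarrow y)\rightarrow y)\rightarrow x\in F$. -}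

module Defs where

open import Level using (Level; _⊔_) renaming (suc to lsuc)
open import Data.Nat using (ℕ; zero; suc)
open import Data.Product using (_×_; ∃)
open import Relation.Unary using (Pred; _∈_; _⊆_)
open import Algebra.Core using (Op₂)
open import Algebra.Structures using (IsCommutativeMonoid)
open import Relation.Binary.Lattice.Bundles using (BoundedLattice)

-- A residuated lattice (L, ∧, ∨, ⊗, →, 0, 1): a bounded lattice (order-theoretic,
-- with top ⊤ = 1 and bottom ⊥ = 0), a commutative monoid (L, ⊗, 1) whose unit is
-- the top element, and the residuation law  x ⊗ y ≤ z  iff  x ≤ y → z.
record ResiduatedLattice c ℓ₁ ℓ₂ : Set (lsuc (c ⊔ ℓ₁ ⊔ ℓ₂)) where
  infixr 7 _⊗_
  infixr 5 _⇒_
  field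
    boundedLattice : BoundedLattice c ℓ₁ ℓ₂
  open BoundedLattice boundedLattice public
  field
    _⊗_ : Op₂ Carrier
    _⇒_ : Op₂ Carrier
    ⊗-isCommutativeMonoid : IsCommutativeMonoid _≈_ _⊗_ ⊤
    residuation-⇒ : ∀ x y z → (x ⊗ y) ≤ z → x ≤ (y ⇒ z)
    residuation-⇐ : ∀ x y z → x ≤ (y ⇒ z) → (x ⊗ y) ≤ z

  _^_ : Carrier → ℕ → Carrier
  x ^ zero = ⊤
  x ^ suc zero = x
  x ^ suc (suc n) = x ⊗ (x ^ suc n)

module _ {c ℓ₁ ℓ₂ : Level} (L : ResiduatedLattice c ℓ₁ ℓ₂) where
  open ResiduatedLattice L

  record IsFilter {ℓ : Level} (F : Pred Carrier ℓ) : Set (c ⊔ ℓ₂ ⊔ ℓ) where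
    field
      nonempty : ∃ λ x → x ∈ F
      ⊗-closed : ∀ {x y} → x ∈ F → y ∈ F → (x ⊗ y) ∈ F
      up-closed : ∀ {x y} → x ∈ F → x ≤ y → y ∈ F

  record IsNFoldFantastic {ℓ : Level} (n : ℕ) (F : Pred Carrier ℓ) : Set (c ⊔ ℓ) where
    field
      one∈F : ⊤ ∈ F
      fantastic : ∀ x y → (y ⇒ x) ∈ F → (((x ^ n) ⇒ y) ⇒ y) ⇒ x ∈ F

-- Let F₁ ⊆ F₂ be filters with F₁ n-fold fantastic and let y ⇒ x ∈ F₂.
-- Put a = y ⇒ x and u = a ⇒ x.  Then y ≤ u, so y ⇒ u lies above ⊤ and hence
-- in F₁, and fantasticity of F₁ gives  ((uⁿ ⇒ y) ⇒ y) ⇒ u ∈ F₁ ⊆ F₂.  Since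
-- x ≤ u and  v ↦ (vⁿ ⇒ y) ⇒ y  is monotone, also  w ⇒ (a ⇒ x) ∈ F₂  with
-- w = (xⁿ ⇒ y) ⇒ y.  Exchanging premises gives  a ⇒ (w ⇒ x) ∈ F₂, and modus
-- ponens with a ∈ F₂ yields  w ⇒ x ∈ F₂, i.e. the fantastic condition for F₂.
module Submission where

open import Defs
open import Level using (Level)
open import Data.Nat using (ℕ; _≥_; zero; suc)
open import Relation.Unary using (Pred; _⊆_)
open import Algebra.Structures using (IsCommutativeMonoid)
import Relation.Binary.Reasoning.PartialOrder as PartialOrderReasoning

module ResiduatedLatticeProperties {c ℓ₁ ℓ₂ : Level} (L : ResiduatedLattice c ℓ₁ ℓ₂) where
  open ResiduatedLattice L
  open IsCommutativeMonoid ⊗-isCommutativeMonoid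
    using (comm; assoc; identityʳ; identityˡ; ∙-congˡ)
    renaming (sym to ≈-sym)
  open PartialOrderReasoning poset

  ⊗-monoˡ : ∀ {x y} z → x ≤ y → (x ⊗ z) ≤ (y ⊗ z)
  ⊗-monoˡ {x} {y} z x≤y =
    residuation-⇐ x z (y ⊗ z) (trans x≤y (residuation-⇒ y z (y ⊗ z) refl))

  ⊗-monoʳ : ∀ {x y} z → x ≤ y → (z ⊗ x) ≤ (z ⊗ y)
  ⊗-monoʳ {x} {y} z x≤y = begin
    z ⊗ x ≈⟨ comm z x ⟩
    x ⊗ z ≤⟨ ⊗-monoˡ z x≤y ⟩
    y ⊗ z ≈⟨ comm y z ⟩
    z ⊗ y ∎

  modus-ponens : ∀ x y → (x ⊗ (x ⇒ y)) ≤ y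
  modus-ponens x y = begin
    x ⊗ (x ⇒ y) ≈⟨ comm x (x ⇒ y) ⟩
    (x ⇒ y) ⊗ x ≤⟨ residuation-⇐ (x ⇒ y) x y refl ⟩
    y           ∎

  ≤-⇒-⇒ : ∀ x y → x ≤ ((x ⇒ y) ⇒ y)
  ≤-⇒-⇒ x y = residuation-⇒ x (x ⇒ y) y (modus-ponens x y)

  ≤-⇒-target : ∀ a x → x ≤ (a ⇒ x)
  ≤-⇒-target a x = residuation-⇒ x a x (begin
    x ⊗ a ≤⟨ ⊗-monoʳ x (maximum a) ⟩
    x ⊗ ⊤ ≈⟨ identityʳ x ⟩
    x     ∎)

  ≤⇒⊤≤⇒ : ∀ {x y} → x ≤ y → ⊤ ≤ (x ⇒ y)
  ≤⇒⊤≤⇒ {x} {y} x≤y = residuation-⇒ ⊤ x y (trans (reflexive (identityˡ x)) x≤y)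

  ⇒-antitoneˡ : ∀ {x x′} y → x ≤ x′ → (x′ ⇒ y) ≤ (x ⇒ y)
  ⇒-antitoneˡ {x} {x′} y x≤x′ = residuation-⇒ (x′ ⇒ y) x y (begin
    (x′ ⇒ y) ⊗ x  ≤⟨ ⊗-monoʳ (x′ ⇒ y) x≤x′ ⟩
    (x′ ⇒ y) ⊗ x′ ≈⟨ comm (x′ ⇒ y) x′ ⟩
    x′ ⊗ (x′ ⇒ y) ≤⟨ modus-ponens x′ y ⟩
    y             ∎)

  ^-mono : ∀ {x u} n → x ≤ u → (x ^ n) ≤ (u ^ n)
  ^-mono zero          x≤u = refl
  ^-mono (suc zero)    x≤u = x≤u
  ^-mono {x} {u} (suc (suc n)) x≤u = begin
    x ⊗ (x ^ suc n) ≤⟨ ⊗-monoˡ (x ^ suc n) x≤u ⟩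
    u ⊗ (x ^ suc n) ≤⟨ ⊗-monoʳ u (^-mono (suc n) x≤u) ⟩
    u ⊗ (u ^ suc n) ∎

  fantasticPremise : ℕ → Carrier → Carrier → Carrier
  fantasticPremise n y x = ((x ^ n) ⇒ y) ⇒ y

  fantasticPremise-mono : ∀ n y {x u} → x ≤ u →
    fantasticPremise n y x ≤ fantasticPremise n y u
  fantasticPremise-mono n y x≤u =
    ⇒-antitoneˡ y (⇒-antitoneˡ y (^-mono n x≤u))

  ⇒-exchange : ∀ w a x → (w ⇒ (a ⇒ x)) ≤ (a ⇒ (w ⇒ x))
  ⇒-exchange w a x =
    residuation-⇒ (w ⇒ (a ⇒ x)) a (w ⇒ x)
      (residuation-⇒ ((w ⇒ (a ⇒ x)) ⊗ a) w x (begin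
        ((w ⇒ (a ⇒ x)) ⊗ a) ⊗ w ≈⟨ assoc (w ⇒ (a ⇒ x)) a w ⟩
        (w ⇒ (a ⇒ x)) ⊗ (a ⊗ w) ≈⟨ ∙-congˡ (comm a w) ⟩
        (w ⇒ (a ⇒ x)) ⊗ (w ⊗ a) ≈⟨ ≈-sym (assoc (w ⇒ (a ⇒ x)) w a) ⟩
        ((w ⇒ (a ⇒ x)) ⊗ w) ⊗ a ≤⟨ ⊗-monoˡ a (residuation-⇐ (w ⇒ (a ⇒ x)) w (a ⇒ x) refl) ⟩
        (a ⇒ x) ⊗ a             ≈⟨ comm (a ⇒ x) a ⟩
        a ⊗ (a ⇒ x)             ≤⟨ modus-ponens a x ⟩
        x                       ∎))

module FilterProperties {c ℓ₁ ℓ₂ ℓ : Level} (L : ResiduatedLattice c ℓ₁ ℓ₂)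
                        {F : Pred (ResiduatedLattice.Carrier L) ℓ} (isFilter : IsFilter L F) where
  open ResiduatedLattice L
  open ResiduatedLatticeProperties L
  open IsFilter isFilter

  filter-modus-ponens : ∀ {a b} → F a → F (a ⇒ b) → F b
  filter-modus-ponens {a} {b} a∈F a⇒b∈F = up-closed (⊗-closed a∈F a⇒b∈F) (modus-ponens a b)

  filter-≤⇒ : F ⊤ → ∀ {x y} → x ≤ y → F (x ⇒ y)
  filter-≤⇒ ⊤∈F x≤y = up-closed ⊤∈F (≤⇒⊤≤⇒ x≤y)

theorem7p15 : {c ℓ₁ ℓ₂ ℓ : Level} (L : ResiduatedLattice c ℓ₁ ℓ₂) (n : ℕ) → n ≥ 1 →
    (F₁ F₂ : Pred (ResiduatedLattice.Carrier L) ℓ) →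
    IsFilter L F₁ → IsFilter L F₂ → F₁ ⊆ F₂ →
    IsNFoldFantastic L n F₁ → IsNFoldFantastic L n F₂
theorem7p15 L n _ F₁ F₂ isFilter₁ isFilter₂ F₁⊆F₂ fantastic₁ = record
  { one∈F     = F₁⊆F₂ (IsNFoldFantastic.one∈F fantastic₁)
  ; fantastic = fantastic₂
  }
  where
  open ResiduatedLattice L
  open ResiduatedLatticeProperties L
  open FilterProperties L isFilter₁ using (filter-≤⇒)
  open FilterProperties L isFilter₂ using (filter-modus-ponens)
  open IsFilter isFilter₂ using (up-closed)

  fantastic₂ : ∀ x y → F₂ (y ⇒ x) → F₂ (fantasticPremise n y x ⇒ x)
  fantastic₂ x y a∈F₂ = filter-modus-ponens a∈F₂ a⇒w⇒x∈F₂
    where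
    a = y ⇒ x
    u = a ⇒ x
    w = fantasticPremise n y x
    -- y ≤ u, so y ⇒ u ∈ F₁ and the fantastic condition of F₁ applies to (u, y).
    wᵤ⇒u∈F₂ : F₂ (fantasticPremise n y u ⇒ u)
    wᵤ⇒u∈F₂ = F₁⊆F₂ (IsNFoldFantastic.fantastic fantastic₁ u y
                 (filter-≤⇒ (IsNFoldFantastic.one∈F fantastic₁) (≤-⇒-⇒ y x)))
    -- x ≤ u, so w ≤ wᵤ and hence wᵤ ⇒ u ≤ w ⇒ u.
    w⇒u∈F₂ : F₂ (w ⇒ u)
    w⇒u∈F₂ = up-closed wᵤ⇒u∈F₂ (⇒-antitoneˡ u (fantasticPremise-mono n y (≤-⇒-target a x)))
    a⇒w⇒x∈F₂ : F₂ (a ⇒ (w ⇒ x))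
    a⇒w⇒x∈F₂ = up-closed w⇒u∈F₂ (⇒-exchange w a x)
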